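{- Let $(C,\sqsubseteq)$ be a complete lattice, let $b^*,b_*\colon C\to C$ be monotone maps with $b^*$ left adjoint to $b_*$ (i.e. $b^*(x)\sqsubseteq y$ iff $x\sqsubseteq b_*(y)$ for all $x,y\in C$), let $a\colon C\to C$ be an up-closure operator, let $i\in C$, and let $f\in C$ with $a(f)\sqsubseteq f$. Suppose that $b^*\circ a\sqsubseteq a\circ b^*$ (equivalently, $a\circ b_*\sqsubseteq b_*\circ a$). Then: (1) $a$ is complete with respect to the map $g=i\sqcup b^*$ (the map $x\mapsto i\sqcup b^*(x)$), i.e. $\alpha(\mu g)=\mu(\alpha\circ g\circ\gamma)$; and (2) $a$ is sound with respect to the map $h=b_*\sqcap f$ (the map $x\mapsto b_*(x)\sqcap f$), i.e. for all $j,x\in C$, if $j\sqsubseteq x\sqsubseteq h(a(x))$ then $j\sqsubseteq \nu h$.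
   Context: All maps are monotone and maps $C\to C$ are ordered pointwise. An up-closure operator is a monotone $a\colon C\to C$ with $x\sqsubseteq a(x)$ and $a(a(x))\sqsubseteq a(x)$ for all $x$. $Pre(a)=\{x\in C\mid a(x)\sqsubseteq x\}$ is a complete lattice with the order of $C$; $\alpha\colon C\to Pre(a)$ is $\alpha(x)=a(x)$ and $\gamma\colon Pre(a)\to C$ is the inclusion. $\mu$ and $\nu$ denote least and greatest fixed points (for $\alpha\circ g\circ\gamma$, the least fixed point in $Pre(a)$). The elements $i,f$ are identified with constant maps when forming $i\sqcup b^*$ and $b_*\sqcap f$. -}

module Defs where

open import Level using (Level; _⊔_; Lift) renaming (suc to lsuc)
open import Data.Product using (Σ; _×_; _,_; proj₁; proj₂)
open import Data.Sum using (_⊎_)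
open import Relation.Unary using (Pred)
open import Relation.Binary.Bundles using (Poset)

record CompleteLattice (c ℓ₁ ℓ₂ : Level) : Set (lsuc (c ⊔ ℓ₁ ⊔ ℓ₂)) where
  field
    poset : Poset c ℓ₁ ℓ₂
  open Poset poset public
  field
    ⨆ : Pred Carrier (c ⊔ ℓ₁ ⊔ ℓ₂) → Carrier
    ⨆-upper : ∀ S x → S x → x ≤ ⨆ S
    ⨆-least : ∀ S y → (∀ x → S x → x ≤ y) → ⨆ S ≤ y
    ⨅ : Pred Carrier (c ⊔ ℓ₁ ⊔ ℓ₂) → Carrier
    ⨅-lower : ∀ S x → S x → ⨅ S ≤ x
    ⨅-greatest : ∀ S y → (∀ x → S x → y ≤ x) → y ≤ ⨅ S

  _⊔L_ : Carrier → Carrier → Carrier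
  x ⊔L y = ⨆ (λ z → Lift (c ⊔ ℓ₁ ⊔ ℓ₂) (z ≈ x ⊎ z ≈ y))

  _⊓L_ : Carrier → Carrier → Carrier
  x ⊓L y = ⨅ (λ z → Lift (c ⊔ ℓ₁ ⊔ ℓ₂) (z ≈ x ⊎ z ≈ y))

  Monotone : (Carrier → Carrier) → Set (c ⊔ ℓ₂)
  Monotone F = ∀ {x y} → x ≤ y → F x ≤ F y

  IsUpClosure : (Carrier → Carrier) → Set (c ⊔ ℓ₂)
  IsUpClosure a = Monotone a × (∀ x → x ≤ a x) × (∀ x → a (a x) ≤ a x)

  _⊣_ : (Carrier → Carrier) → (Carrier → Carrier) → Set (c ⊔ ℓ₂)
  l ⊣ r = ∀ x y → (l x ≤ y → x ≤ r y) × (x ≤ r y → l x ≤ y)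

  Pre : (Carrier → Carrier) → Set (c ⊔ ℓ₂)
  Pre a = Σ Carrier (λ x → a x ≤ x)

  γ : {a : Carrier → Carrier} → Pre a → Carrier
  γ = proj₁

  α : (a : Carrier → Carrier) → (∀ x → a (a x) ≤ a x) → Carrier → Pre a
  α a idem x = a x , idem x

  _≤P_ : {a : Carrier → Carrier} → Pre a → Pre a → Set ℓ₂
  p ≤P q = proj₁ p ≤ proj₁ q

  _≈P_ : {a : Carrier → Carrier} → Pre a → Pre a → Set ℓ₁
  p ≈P q = proj₁ p ≈ proj₁ q

IsLeastFixedPoint : ∀ {a e r} {A : Set a} → (A → A → Set e) → (A → A → Set r) →
                    (A → A) → A → Set (a ⊔ e ⊔ r)
IsLeastFixedPoint _≈_ _≤_ F m = (F m ≈ m) × (∀ x → F x ≈ x → m ≤ x)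

IsGreatestFixedPoint : ∀ {a e r} {A : Set a} → (A → A → Set e) → (A → A → Set r) →
                       (A → A) → A → Set (a ⊔ e ⊔ r)
IsGreatestFixedPoint _≈_ _≤_ F n = (F n ≈ n) × (∀ x → F x ≈ x → x ≤ n)

module Submission where

-- The proof goes through two general criteria, valid for any monotone map:
--  * if g ∘ a ⊑ a ∘ g, then a(μ g) is the least fixed point of α ∘ g ∘ γ,
--    i.e. a is complete for g;
--  * if a ∘ h ⊑ h ∘ a, then every x ⊑ h(a x) has a(x) post-fixed for h,
--    hence x ⊑ ν h, i.e. a is sound for h.
-- Both rely on the Knaster–Tarski bounds: μ F lies below every pre-fixed
-- point and ν F above every post-fixed point.  It remains to check the two
-- commutations: g ∘ a ⊑ a ∘ g follows from b* ∘ a ⊑ a ∘ b* since a is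
-- extensive; for h, the hypothesis transfers along the adjunction to
-- a ∘ b₊ ⊑ b₊ ∘ a, and a f ⊑ f handles the constant part.

open import Defs
open import Level using (Level; Lift; lift; lower)
open import Data.Product using (_×_; _,_; proj₁; proj₂)
open import Data.Sum using (_⊎_; inj₁; inj₂)
import Relation.Binary.Reasoning.PartialOrder as PosetReasoning

module Development {c ℓ₁ ℓ₂ : Level} (L : CompleteLattice c ℓ₁ ℓ₂) where
  open CompleteLattice L
  open PosetReasoning poset

  ⊔-upperˡ : ∀ x y → x ≤ x ⊔L y
  ⊔-upperˡ x y = ⨆-upper _ x (lift (inj₁ Eq.refl))

  ⊔-upperʳ : ∀ x y → y ≤ x ⊔L y
  ⊔-upperʳ x y = ⨆-upper _ y (lift (inj₂ Eq.refl))

  ⊔-least : ∀ {x y z} → x ≤ z → y ≤ z → x ⊔L y ≤ z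
  ⊔-least {x} {y} {z} x≤z y≤z = ⨆-least _ z bound
    where
    bound : ∀ w → Lift _ (w ≈ x ⊎ w ≈ y) → w ≤ z
    bound w (lift (inj₁ w≈x)) = trans (reflexive w≈x) x≤z
    bound w (lift (inj₂ w≈y)) = trans (reflexive w≈y) y≤z

  ⊓-lowerˡ : ∀ x y → x ⊓L y ≤ x
  ⊓-lowerˡ x y = ⨅-lower _ x (lift (inj₁ Eq.refl))

  ⊓-lowerʳ : ∀ x y → x ⊓L y ≤ y
  ⊓-lowerʳ x y = ⨅-lower _ y (lift (inj₂ Eq.refl))

  ⊓-greatest : ∀ {x y z} → z ≤ x → z ≤ y → z ≤ x ⊓L y
  ⊓-greatest {x} {y} {z} z≤x z≤y = ⨅-greatest _ z bound
    where
    bound : ∀ w → Lift _ (w ≈ x ⊎ w ≈ y) → z ≤ w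
    bound w (lift (inj₁ w≈x)) = trans z≤x (reflexive (Eq.sym w≈x))
    bound w (lift (inj₂ w≈y)) = trans z≤y (reflexive (Eq.sym w≈y))

  -- Knaster–Tarski: the meet of all pre-fixed points of a monotone F is a
  -- fixed point, so the least fixed point lies below every pre-fixed point.
  lfp-below-prefixed : (F : Carrier → Carrier) → Monotone F →
    ∀ μF → IsLeastFixedPoint _≈_ _≤_ F μF → ∀ y → F y ≤ y → μF ≤ y
  lfp-below-prefixed F monoF μF (_ , least) y Fy≤y =
    trans (least m Fm≈m) (⨅-lower Prefixed y (lift Fy≤y))
    where
    Prefixed = λ z → Lift (c Level.⊔ ℓ₁ Level.⊔ ℓ₂) (F z ≤ z)
    m = ⨅ Prefixed
    Fm≤m : F m ≤ m
    Fm≤m = ⨅-greatest Prefixed (F m) (λ z pre → trans (monoF (⨅-lower Prefixed z pre)) (lower pre))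
    Fm≈m : F m ≈ m
    Fm≈m = antisym Fm≤m (⨅-lower Prefixed (F m) (lift (monoF Fm≤m)))

  gfp-above-postfixed : (F : Carrier → Carrier) → Monotone F →
    ∀ νF → IsGreatestFixedPoint _≈_ _≤_ F νF → ∀ y → y ≤ F y → y ≤ νF
  gfp-above-postfixed F monoF νF (_ , greatest) y y≤Fy =
    trans (⨆-upper Postfixed y (lift y≤Fy)) (greatest m Fm≈m)
    where
    Postfixed = λ z → Lift (c Level.⊔ ℓ₁ Level.⊔ ℓ₂) (z ≤ F z)
    m = ⨆ Postfixed
    m≤Fm : m ≤ F m
    m≤Fm = ⨆-least Postfixed (F m) (λ z post → trans (lower post) (monoF (⨆-upper Postfixed z post)))
    Fm≈m : F m ≈ m
    Fm≈m = antisym (⨆-upper Postfixed (F m) (lift (monoF m≤Fm))) m≤Fm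

  complete-if-commuting : (a g : Carrier → Carrier) (upc : IsUpClosure a) →
    Monotone g → (∀ x → g (a x) ≤ a (g x)) →
    let αa = α a (proj₂ (proj₂ upc)) in
    ∀ μg → IsLeastFixedPoint _≈_ _≤_ g μg →
    ∀ μg' → IsLeastFixedPoint _≈P_ _≤P_ (λ p → αa (g (γ p))) μg' →
    αa μg ≈P μg'
  complete-if-commuting a g (monoA , extA , idemA) monoG ga≤ag
                        μg lfp@(gμ≈μ , _) (q , aq≤q) (agq≈q , leastP) =
    antisym aμ≤q q≤aμ
    where
    -- q is pre-fixed for g, so μ g ⊑ q and a(μ g) ⊑ a q ⊑ q.
    aμ≤q : a μg ≤ q
    aμ≤q = trans (monoA (lfp-below-prefixed g monoG μg lfp q
                          (trans (extA (g q)) (reflexive agq≈q))))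
                 aq≤q
    aμ-fixed : a (g (a μg)) ≈ a μg
    aμ-fixed = antisym
      (begin
        a (g (a μg)) ≤⟨ monoA (ga≤ag μg) ⟩
        a (a (g μg)) ≤⟨ idemA (g μg) ⟩
        a (g μg)     ≤⟨ monoA (reflexive gμ≈μ) ⟩
        a μg         ∎)
      (monoA (trans (reflexive (Eq.sym gμ≈μ)) (monoG (extA μg))))
    q≤aμ : q ≤ a μg
    q≤aμ = leastP (a μg , idemA μg) aμ-fixed

  -- Soundness criterion: if a ∘ h ⊑ h ∘ a, then x ⊑ h(a x) makes a(x)
  -- post-fixed for h, so everything below x lies below ν h.
  sound-if-commuting : (a h : Carrier → Carrier) → IsUpClosure a →
    Monotone h → (∀ x → a (h x) ≤ h (a x)) →
    ∀ νh → IsGreatestFixedPoint _≈_ _≤_ h νh →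
    ∀ j x → j ≤ x → x ≤ h (a x) → j ≤ νh
  sound-if-commuting a h (monoA , extA , idemA) monoH ah≤ha νh gfp j x j≤x x≤hax =
    begin
      j   ≤⟨ j≤x ⟩
      x   ≤⟨ extA x ⟩
      a x ≤⟨ gfp-above-postfixed h monoH νh gfp (a x) ax-postfixed ⟩
      νh  ∎
    where
    ax-postfixed : a x ≤ h (a x)
    ax-postfixed = begin
      a x           ≤⟨ monoA x≤hax ⟩
      a (h (a x))   ≤⟨ ah≤ha (a x) ⟩
      h (a (a x))   ≤⟨ monoH (idemA x) ⟩
      h (a x)       ∎

  -- A map commuting (laxly) with a closure still does so after joining a
  -- constant: (i ⊔ b)(a x) ⊑ a i ⊔ a(b x) ⊑ a(i ⊔ b x).
  join-const-commutes : (a b : Carrier → Carrier) (i : Carrier) → IsUpClosure a →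
    (∀ x → b (a x) ≤ a (b x)) → ∀ x → i ⊔L b (a x) ≤ a (i ⊔L b x)
  join-const-commutes a b i (monoA , extA , _) ba≤ab x =
    ⊔-least (trans (⊔-upperˡ i (b x)) (extA (i ⊔L b x)))
            (trans (ba≤ab x) (monoA (⊔-upperʳ i (b x))))

  meet-const-commutes : (a r : Carrier → Carrier) (f : Carrier) → IsUpClosure a →
    a f ≤ f → (∀ x → a (r x) ≤ r (a x)) → ∀ x → a (r x ⊓L f) ≤ r (a x) ⊓L f
  meet-const-commutes a r f (monoA , _ , _) af≤f ar≤ra x =
    ⊓-greatest (trans (monoA (⊓-lowerˡ (r x) f)) (ar≤ra x))
               (trans (monoA (⊓-lowerʳ (r x) f)) af≤f)

  -- Lax commutation transfers along an adjunction l ⊣ r: if l ∘ a ⊑ a ∘ l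
  -- then a ∘ r ⊑ r ∘ a, since l(a(r y)) ⊑ a(l(r y)) ⊑ a y by the counit.
  conjugate-commutes : (l r a : Carrier → Carrier) → l ⊣ r → Monotone a →
    (∀ x → l (a x) ≤ a (l x)) → ∀ y → a (r y) ≤ r (a y)
  conjugate-commutes l r a adj monoA la≤al y =
    proj₁ (adj (a (r y)) (a y)) (trans (la≤al (r y)) (monoA counit))
    where
    counit : l (r y) ≤ y
    counit = proj₂ (adj (r y) y) refl

  ⊔-monotoneʳ : (i : Carrier) (b : Carrier → Carrier) → Monotone b → Monotone (λ x → i ⊔L b x)
  ⊔-monotoneʳ i b monoB x≤y = ⊔-least (⊔-upperˡ _ _) (trans (monoB x≤y) (⊔-upperʳ _ _))

  ⊓-monotoneˡ : (f : Carrier) (r : Carrier → Carrier) → Monotone r → Monotone (λ x → r x ⊓L f)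
  ⊓-monotoneˡ f r monoR x≤y = ⊓-greatest (trans (⊓-lowerˡ _ _) (monoR x≤y)) (⊓-lowerʳ _ _)

open Development

theorem6p3 : ∀ {c ℓ₁ ℓ₂ : Level} (L : CompleteLattice c ℓ₁ ℓ₂) →
    let open CompleteLattice L in
    (b* b₊ a : Carrier → Carrier) (i f : Carrier) →
    Monotone b* → Monotone b₊ → b* ⊣ b₊ →
    (upc : IsUpClosure a) → a f ≤ f →
    (∀ x → b* (a x) ≤ a (b* x)) →
    let g = λ x → i ⊔L b* x
        h = λ x → b₊ x ⊓L f
        αa = α a (proj₂ (proj₂ upc))
    in
    -- (1) completeness: α(μ g) = μ(α ∘ g ∘ γ)
    (∀ (μg : Carrier) → IsLeastFixedPoint _≈_ _≤_ g μg →
     ∀ (μg' : Pre a) → IsLeastFixedPoint _≈P_ _≤P_ (λ p → αa (g (γ p))) μg' →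
     αa μg ≈P μg')
    ×
    -- (2) soundness: j ⊑ x ⊑ h(a x) implies j ⊑ ν h
    (∀ (νh : Carrier) → IsGreatestFixedPoint _≈_ _≤_ h νh →
     ∀ j x → j ≤ x → x ≤ h (a x) → j ≤ νh)
theorem6p3 L b* b₊ a i f mono-b* mono-b₊ adj upc af≤f b*a≤ab* =
  complete-if-commuting L a (λ x → i ⊔L b* x) upc
    (⊔-monotoneʳ L i b* mono-b*)
    (join-const-commutes L a b* i upc b*a≤ab*)
  ,
  sound-if-commuting L a (λ x → b₊ x ⊓L f) upc
    (⊓-monotoneˡ L f b₊ mono-b₊)
    (meet-const-commutes L a b₊ f upc af≤f
      (conjugate-commutes L b* b₊ a adj (proj₁ upc) b*a≤ab*))
  where open CompleteLattice L
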